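{- Let $F\colon\mathbf{Set}\to\mathbf{Set}$ be a functor and $\Lambda$ a separating set of evaluation maps $\lambda\colon F2\to2$ (not necessarily monotone). Let $\mathit{id}_2,\mathit{one},\mathit{zero},\mathit{neg}\colon 2\to 2$ be the identity, the constant-$1$ map, the constant-$0$ map and negation. Then $\Lambda'=\{\lambda,\ \lambda\circ F\mathit{one},\ \lambda\circ F\mathit{zero},\ \lambda\circ F\mathit{neg}\mid\lambda\in\Lambda\}$ is strongly separating. Moreover, for every $\lambda\in\Lambda$ and every formula $\phi$: $[\lambda\circ F\mathit{one}]\phi\equiv[\lambda]\mathit{tt}$, $[\lambda\circ F\mathit{zero}]\phi\equiv[\lambda]\mathit{ff}$, and $[\lambda\circ F\mathit{neg}]\phi\equiv[\lambda](\neg\phi)$.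
   Context: $2=\{0,1\}$. A set $\Lambda$ of evaluation maps $\lambda\colon F2\to2$ is separating if for every set $X$ and all $t_0\ne t_1$ in $FX$ there exist $\lambda\in\Lambda$ and $p\colon X\to2$ with $\lambda(Fp(t_0))\neq\lambda(Fp(t_1))$; it is strongly separating if it is separating and for all $t_0\ne t_1$ in $F2$ there is $\lambda\in\Lambda$ with $\lambda(t_0)\ne\lambda(t_1)$. Modal formulas: $\phi::=\bigwedge\Phi\mid\neg\phi\mid[\lambda]\phi$ ($\Phi$ a set of formulas, $\lambda$ an evaluation map); for a coalgebra $\alpha\colon X\to FX$ the semantics $[\![\phi]\!]_\alpha\colon X\to 2$ interprets conjunction and negation as usual and $[\![[\lambda]\phi]\!]_\alpha=\lambda\circ F[\![\phi]\!]_\alpha\circ\alpha$. $\mathit{tt}$ is the empty conjunction, $\mathit{ff}=\neg\mathit{tt}$. $\phi\equiv\psi$ means $[\![\phi]\!]_\alpha=[\![\psi]\!]_\alpha$ for all coalgebras $\alpha$. -}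

module Defs where

open import Data.Bool using (Bool; true; false; not)
open import Data.Empty using (⊥)
open import Data.Product using (Σ; _×_; _,_; ∃)
open import Data.Sum using (_⊎_)
open import Function using (id; _∘_)
open import Relation.Binary.PropositionalEquality using (_≡_)
open import Relation.Nullary using (¬_)

-- A functor Set → Set (with the functor laws; fmap-cong expresses that
-- fmap acts on functions, which in Set are extensional).
record Functor : Set₁ where
  field
    F      : Set → Set
    fmap   : {A B : Set} → (A → B) → F A → F B
    fmap-id   : {A : Set} (t : F A) → fmap id t ≡ t
    fmap-∘    : {A B C : Set} (f : A → B) (g : B → C) (t : F A) →
                fmap (g ∘ f) t ≡ fmap g (fmap f t)
    fmap-cong : {A B : Set} {f g : A → B} → (∀ a → f a ≡ g a) →
                (t : F A) → fmap f t ≡ fmap g t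

module _ (Fun : Functor) where
  open Functor Fun

  EvalMap : Set
  EvalMap = F Bool → Bool

  EvalSet : Set₁
  EvalSet = EvalMap → Set

  Separating : EvalSet → Set₁
  Separating Λ = (X : Set) (t₀ t₁ : F X) → ¬ (t₀ ≡ t₁) →
    Σ EvalMap λ l → Λ l × Σ (X → Bool) λ p → ¬ (l (fmap p t₀) ≡ l (fmap p t₁))

  StronglySeparating : EvalSet → Set₁
  StronglySeparating Λ = Separating Λ ×
    ((t₀ t₁ : F Bool) → ¬ (t₀ ≡ t₁) →
      Σ EvalMap λ l → Λ l × ¬ (l t₀ ≡ l t₁))

  idB one zero neg : Bool → Bool
  idB  = id
  one  = λ _ → true
  zero = λ _ → false
  neg  = not

  _≐_ : EvalMap → EvalMap → Set
  μ ≐ l = ∀ t → μ t ≡ l t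

  Λ' : EvalSet → EvalSet
  Λ' Λ μ = Σ EvalMap λ l → Λ l ×
    (μ ≐ l ⊎ μ ≐ (l ∘ fmap one) ⊎ μ ≐ (l ∘ fmap zero) ⊎ μ ≐ (l ∘ fmap neg))

  data Formula : Set₁ where
    ⋀     : (I : Set) → (I → Formula) → Formula
    ~_    : Formula → Formula
    [_]_  : EvalMap → Formula → Formula

  tt ff : Formula
  tt = ⋀ ⊥ (λ ())
  ff = ~ tt

  -- semantics [[φ]]_α = f, as an inductive (functional) relation, since an
  -- infinitary conjunction is not computable as a Bool constructively.
  data Sem {X : Set} (α : X → F X) : Formula → (X → Bool) → Set₁ where
    sem-⋀ : {I : Set} {Φ : I → Formula} {f : X → Bool}
            (gs : I → X → Bool) → ((i : I) → Sem α (Φ i) (gs i)) →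
            (∀ x → (f x ≡ true → ∀ i → gs i x ≡ true) ×
                   ((∀ i → gs i x ≡ true) → f x ≡ true)) →
            Sem α (⋀ I Φ) f
    sem-~ : {φ : Formula} {f : X → Bool} (g : X → Bool) → Sem α φ g →
            (∀ x → f x ≡ not (g x)) → Sem α (~ φ) f
    sem-□ : {l : EvalMap} {φ : Formula} {f : X → Bool} (g : X → Bool) →
            Sem α φ g → (∀ x → f x ≡ l (fmap g (α x))) → Sem α ([ l ] φ) f

  _≡F_ : Formula → Formula → Set₁
  φ ≡F ψ = (X : Set) (α : X → F X) (f g : X → Bool) →
           Sem α φ f → Sem α ψ g → ∀ x → f x ≡ g x

module Submission where

-- Proof idea.
--  * Since the semantics is given as a relation, we first show that it is
--    functional (denotations are unique) and compute the denotations of tt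
--    and ff.
--  * The semantics of a modality factors through functoriality:
--    [λ ∘ F p]φ denotes λ ∘ F (p ∘ ⟦φ⟧) ∘ α.  Hence [λ ∘ F p]φ ≡ [λ]ψ as soon
--    as p ∘ ⟦φ⟧ = ⟦ψ⟧ pointwise (modal-precompose); the three equivalences are
--    the instances (one, tt), (zero, ff) and (neg, ¬φ).
--  * Every map p : 2 → 2 is one of id, one, zero, neg, so for λ ∈ Λ the
--    evaluation map λ ∘ F p agrees with a member of Λ'.  Strong separation
--    of Λ' follows: separation is inherited from Λ ⊆ Λ', and distinct
--    t₀ t₁ : F2 are separated by some λ ∘ F p with λ ∈ Λ, which lies in Λ'.

open import Defs
open import Data.Bool using (Bool; true; false; not)
open import Data.Product using (_×_; _,_; Σ; proj₁; proj₂)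
open import Data.Sum using (inj₁; inj₂)
open import Function using (_∘_)
open import Relation.Binary.PropositionalEquality
  using (_≡_; refl; sym; trans; cong; module ≡-Reasoning)
open import Relation.Nullary using (¬_)

module _ (Fun : Functor) where
  open Functor Fun

  true-iff⇒≡ : {a b : Bool} → (a ≡ true → b ≡ true) → (b ≡ true → a ≡ true) → a ≡ b
  true-iff⇒≡ {true}  {_}     a⇒b _   = sym (a⇒b refl)
  true-iff⇒≡ {false} {true}  _   b⇒a = b⇒a refl
  true-iff⇒≡ {false} {false} _   _   = refl

  sem-unique : {X : Set} {α : X → F X} {φ : Formula Fun} {f g : X → Bool} →
               Sem Fun α φ f → Sem Fun α φ g → ∀ x → f x ≡ g x
  sem-unique (sem-⋀ gs hs c) (sem-⋀ gs' hs' c') x =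
    true-iff⇒≡ (λ fx → proj₂ (c' x) λ i → trans (sym (same i)) (proj₁ (c x) fx i))
               (λ gx → proj₂ (c x) λ i → trans (same i) (proj₁ (c' x) gx i))
    where
      same : ∀ i → gs i x ≡ gs' i x
      same i = sem-unique (hs i) (hs' i) x
  sem-unique (sem-~ g s e) (sem-~ g' s' e') x =
    trans (e x) (trans (cong not (sem-unique s s' x)) (sym (e' x)))
  sem-unique {α = α} {φ = [ l ] _} (sem-□ g s e) (sem-□ g' s' e') x =
    trans (e x) (trans (cong l (fmap-cong (λ y → sem-unique s s' y) (α x))) (sym (e' x)))

  sem-tt : {X : Set} {α : X → F X} {g : X → Bool} → Sem Fun α (tt Fun) g → ∀ x → g x ≡ true
  sem-tt (sem-⋀ _ _ c) x = proj₂ (c x) (λ ())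

  sem-ff : {X : Set} {α : X → F X} {g : X → Bool} → Sem Fun α (ff Fun) g → ∀ x → g x ≡ false
  sem-ff (sem-~ _ s e) x = trans (e x) (cong not (sem-tt s x))

  -- Precomposing an evaluation map with F p amounts to postcomposing the
  -- argument denotation with p: [λ ∘ F p]φ ≡ [λ]ψ whenever p ∘ ⟦φ⟧ = ⟦ψ⟧.
  modal-precompose : (l : EvalMap Fun) (p : Bool → Bool) (φ ψ : Formula Fun) →
    (∀ {X : Set} {α : X → F X} {f g : X → Bool} →
       Sem Fun α φ f → Sem Fun α ψ g → ∀ x → p (f x) ≡ g x) →
    _≡F_ Fun ([_]_ (l ∘ fmap p) φ) ([_]_ l ψ)
  modal-precompose l p φ ψ p∘φ≗ψ X α f g (sem-□ f₁ s₁ e₁) (sem-□ g₁ s₂ e₂) x = begin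
    f x                        ≡⟨ e₁ x ⟩
    l (fmap p (fmap f₁ (α x))) ≡⟨ cong l (sym (fmap-∘ f₁ p (α x))) ⟩
    l (fmap (p ∘ f₁) (α x))    ≡⟨ cong l (fmap-cong (p∘φ≗ψ s₁ s₂) (α x)) ⟩
    l (fmap g₁ (α x))          ≡⟨ sym (e₂ x) ⟩
    g x                        ∎
    where open ≡-Reasoning

  precompose-agree : (l : EvalMap Fun) {p q : Bool → Bool} →
    q true ≡ p true → q false ≡ p false → ∀ t → l (fmap q t) ≡ l (fmap p t)
  precompose-agree l qt qf t = cong l (fmap-cong (λ { true → qt ; false → qf }) t)

  precompose∈Λ' : (Λ : EvalSet Fun) (l : EvalMap Fun) → Λ l → (p : Bool → Bool) →
    Σ (EvalMap Fun) λ μ → Λ' Fun Λ μ × (∀ t → μ t ≡ l (fmap p t))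
  precompose∈Λ' Λ l Λl p with p true in pt | p false in pf
  ... | true  | true  = l ∘ fmap (one Fun)  , (l , Λl , inj₂ (inj₁ (λ _ → refl))) ,
                        precompose-agree l (sym pt) (sym pf)
  ... | false | false = l ∘ fmap (zero Fun) , (l , Λl , inj₂ (inj₂ (inj₁ (λ _ → refl)))) ,
                        precompose-agree l (sym pt) (sym pf)
  ... | false | true  = l ∘ fmap (neg Fun)  , (l , Λl , inj₂ (inj₂ (inj₂ (λ _ → refl)))) ,
                        precompose-agree l (sym pt) (sym pf)
  ... | true  | false = l , (l , Λl , inj₁ (λ _ → refl)) ,
                        λ t → trans (cong l (sym (fmap-id t))) (precompose-agree l (sym pt) (sym pf) t)

  Λ'-strongly-separating : (Λ : EvalSet Fun) → Separating Fun Λ →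
                           StronglySeparating Fun (Λ' Fun Λ)
  Λ'-strongly-separating Λ sep = separating , separates-F2
    where
      separating : Separating Fun (Λ' Fun Λ)
      separating X t₀ t₁ t₀≢t₁ with sep X t₀ t₁ t₀≢t₁
      ... | l , Λl , p , differ = l , (l , Λl , inj₁ (λ _ → refl)) , p , differ

      separates-F2 : (t₀ t₁ : F Bool) → ¬ (t₀ ≡ t₁) →
                     Σ (EvalMap Fun) λ μ → Λ' Fun Λ μ × ¬ (μ t₀ ≡ μ t₁)
      separates-F2 t₀ t₁ t₀≢t₁ with sep Bool t₀ t₁ t₀≢t₁
      ... | l , Λl , p , differ with precompose∈Λ' Λ l Λl p
      ... | μ , μ∈Λ' , μ≗ = μ , μ∈Λ' , λ same → differ (trans (sym (μ≗ t₀)) (trans same (μ≗ t₁)))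

  one-equiv : (l : EvalMap Fun) (φ : Formula Fun) →
              _≡F_ Fun ([_]_ (l ∘ fmap (one Fun)) φ) ([_]_ l (tt Fun))
  one-equiv l φ = modal-precompose l (one Fun) φ (tt Fun) λ _ s x → sym (sem-tt s x)

  zero-equiv : (l : EvalMap Fun) (φ : Formula Fun) →
               _≡F_ Fun ([_]_ (l ∘ fmap (zero Fun)) φ) ([_]_ l (ff Fun))
  zero-equiv l φ = modal-precompose l (zero Fun) φ (ff Fun) λ _ s x → sym (sem-ff s x)

  neg-equiv : (l : EvalMap Fun) (φ : Formula Fun) →
              _≡F_ Fun ([_]_ (l ∘ fmap (neg Fun)) φ) ([_]_ l (~_ φ))
  neg-equiv l φ = modal-precompose l (neg Fun) φ (~_ φ)
    λ { s (sem-~ g s' e) x → trans (cong not (sem-unique s s' x)) (sym (e x)) }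

lemma5 : (Fun : Functor) (Λ : EvalSet Fun) → Separating Fun Λ →
    StronglySeparating Fun (Λ' Fun Λ) ×
    ((l : EvalMap Fun) → Λ l → (φ : Formula Fun) →
    (_≡F_ Fun ([_]_ (l ∘ Functor.fmap Fun (one Fun)) φ) ([_]_ l (tt Fun))) ×
    (_≡F_ Fun ([_]_ (l ∘ Functor.fmap Fun (zero Fun)) φ) ([_]_ l (ff Fun))) ×
    (_≡F_ Fun ([_]_ (l ∘ Functor.fmap Fun (neg Fun)) φ) ([_]_ l (~_ φ))))
lemma5 Fun Λ sep =
  Λ'-strongly-separating Fun Λ sep ,
  λ l _ φ → one-equiv Fun l φ , zero-equiv Fun l φ , neg-equiv Fun l φ
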